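{- Let $G$ be a finite bipartite graph with color classes $A$ and $B$, and let $b:V(G)\to\mathbb{Z}_{\ge0}$. A set $Z\subseteq V(G)$ is a $b$-verifying set if and only if there exist a normalized lower ideal $\mathcal{I}_A$ and a normalized upper ideal $\mathcal{I}_B$ of the poset $(\mathcal{F},\le_A)$ with $\mathcal{I}_A\cup\mathcal{I}_B=\mathcal{F}$ and $\mathcal{I}_A\cap\mathcal{I}_B=\emptyset$, such that $Z=Z_A\cup Z_B$ where $Z_A=\bigcup_{H\in\mathcal{I}_A}(V(H)\cap A)$ and $Z_B=\bigcup_{H\in\mathcal{I}_B}(V(H)\cap B)$.
   Context: $\delta(v)$: edges incident with $v$. A $b$-matching is $M\subseteq E(G)$ with $|\delta(v)\cap M|\le b(v)$ for all $v$; maximum = largest cardinality. $v$ is $M$-loose if $|\delta(v)\cap M|<b(v)$. An edge is allowed if in some maximum $b$-matching, forbidden otherwise; an allowed edge is inevitable if in every maximum $b$-matching, flexible otherwise. A flexible component is $G[V(K)]$ for $K$ a connected component of $(V(G),\{\text{flexible edges}\})$; $\mathcal{F}$ is the set of these. $\mathcal{D}$: vertices that are $M$-loose for some maximum $b$-matching $M$. $C\in\mathcal{F}$ is loose if $V(C)\cap\mathcal{D}\ne\emptyset$. $v$ is inactive if $b(v)=0$, and then $G[\{v\}]\in\mathcal{F}$ is called inactive. For $W\in\{A,B\}$, $C\in\mathcal{F}$ is inconsistent hooked up by $W$ if either $C$ is loose with $V(C)\cap\mathcal{D}\cap W\ne\emptyset$, or $C$ is inactive and its vertex has a neighbor in $\mathcal{D}\cap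 W$; $\mathcal{I}_W^{\mathrm{inc}}$ denotes the set of these. $\overline W$ is the other color class. For $C_1,C_2\in\mathcal{F}$, $C_1\preceq^\circ_A C_2$ if $C_1=C_2$, or an inevitable edge joins $V(C_1)\cap A$ to $V(C_2)\cap B$, or a forbidden edge joins $V(C_2)\cap A$ to $V(C_1)\cap B$; $C_1\le_A C_2$ if there are $D_1=C_1,D_2,\dots,D_k=C_2$ in $\mathcal{F}$ with $D_i\preceq^\circ_A D_{i+1}$ for all $i$ (this is a partial order). A lower ideal $\mathcal{I}$ of $(\mathcal{F},\le_A)$ is normalized if $\mathcal{I}_A^{\mathrm{inc}}\subseteq\mathcal{I}$ and $\mathcal{I}_B^{\mathrm{inc}}\cap\mathcal{I}=\emptyset$; an upper ideal $\mathcal{J}$ is normalized if $\mathcal{I}_A^{\mathrm{inc}}\cap\mathcal{J}=\emptyset$ and $\mathcal{I}_B^{\mathrm{inc}}\subseteq\mathcal{J}$. For $Z\subseteq V(G)$, $E[Z]$ is the set of edges with both ends in $Z$, and $b(X)=\sum_{v\in X}b(v)$. $Z$ is a $b$-verifying set if $b(V(G)\setminus Z)+|E[Z]|$ equals the size of a maximum $b$-matching (this is the minimum of $b(V(G)\setminus Z)+|E[Z]|$ over all $Z$). -}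

module Defs where

open import Data.Nat using (ℕ; zero; suc; _+_; _≤_; _<_)
open import Data.Fin using (Fin; zero; suc)
open import Data.Bool using (Bool; true; false; _∧_; if_then_else_)
open import Data.Sum using (_⊎_; inj₁; inj₂)
open import Data.Product using (Σ; ∃; _×_; _,_)
open import Data.Empty using (⊥)
open import Data.Unit using (⊤)
open import Relation.Binary.PropositionalEquality using (_≡_)
open import Relation.Binary.Construct.Closure.ReflexiveTransitive using (Star)

sumFin : (n : ℕ) → (Fin n → ℕ) → ℕ
sumFin zero    f = 0
sumFin (suc n) f = f zero + sumFin n (λ i → f (suc i))

[_] : Bool → ℕ
[ true ]  = 1
[ false ] = 0

-- A finite (simple) bipartite graph with colour classes A = Fin p and
-- B = Fin q is given by its bipartite adjacency E : Fin p → Fin q → Bool.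
-- Vertex set V(G) = A ⊎ B  (inj₁ = vertices of A, inj₂ = vertices of B).
V : ℕ → ℕ → Set
V p q = Fin p ⊎ Fin q

data Side : Set where
  sideA sideB : Side

inSide : {p q : ℕ} → Side → V p q → Set
inSide sideA (inj₁ _) = ⊤
inSide sideA (inj₂ _) = ⊥
inSide sideB (inj₁ _) = ⊥
inSide sideB (inj₂ _) = ⊤

module _ {p q : ℕ} (E : Fin p → Fin q → Bool) (b : V p q → ℕ) where

  Adj : V p q → V p q → Set
  Adj (inj₁ i) (inj₂ j) = E i j ≡ true
  Adj (inj₂ j) (inj₁ i) = E i j ≡ true
  Adj (inj₁ _) (inj₁ _) = ⊥
  Adj (inj₂ _) (inj₂ _) = ⊥

  -- an edge subset is M : Fin p → Fin q → Bool with M ⊆ E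
  EdgeSet : Set
  EdgeSet = Fin p → Fin q → Bool

  deg : EdgeSet → V p q → ℕ
  deg M (inj₁ i) = sumFin q (λ j → [ M i j ])
  deg M (inj₂ j) = sumFin p (λ i → [ M i j ])

  size : EdgeSet → ℕ
  size M = sumFin p (λ i → sumFin q (λ j → [ M i j ]))

  IsBMatching : EdgeSet → Set
  IsBMatching M = (∀ i j → M i j ≡ true → E i j ≡ true) × (∀ v → deg M v ≤ b v)

  IsMaxBMatching : EdgeSet → Set
  IsMaxBMatching M = IsBMatching M × (∀ M' → IsBMatching M' → size M' ≤ size M)

  Allowed : Fin p → Fin q → Set
  Allowed i j = E i j ≡ true × Σ EdgeSet (λ M → IsMaxBMatching M × M i j ≡ true)

  Forbidden : Fin p → Fin q → Set
  Forbidden i j = E i j ≡ true × (Allowed i j → ⊥)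

  Inevitable : Fin p → Fin q → Set
  Inevitable i j = Allowed i j × (∀ M → IsMaxBMatching M → M i j ≡ true)

  Flexible : Fin p → Fin q → Set
  Flexible i j = Allowed i j × (Inevitable i j → ⊥)

  FlexAdj : V p q → V p q → Set
  FlexAdj u v = Σ (Fin p) λ i → Σ (Fin q) λ j → Flexible i j ×
    ((u ≡ inj₁ i × v ≡ inj₂ j) ⊎ (u ≡ inj₂ j × v ≡ inj₁ i))

  -- u ~ v : u and v lie in the same flexible component.
  -- A set of flexible components is encoded by the set of vertices it covers,
  -- i.e. a predicate on V(G) that is constant on ~-classes.
  _~_ : V p q → V p q → Set
  _~_ = Star FlexAdj

  InD : V p q → Set
  InD v = Σ EdgeSet λ M → IsMaxBMatching M × deg M v < b v

  -- the component of x is inconsistent hooked up by W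
  Inc : Side → V p q → Set
  Inc W x =
    (Σ (V p q) λ v → x ~ v × inSide W v × InD v)
    ⊎ (Σ (V p q) λ v → x ~ v × b v ≡ 0 × (∀ y → x ~ y → y ≡ v) ×
         Σ (V p q) λ w → Adj v w × inSide W w × InD w)

  -- C₁ ⪯°_A C₂, on representatives x ∈ C₁, y ∈ C₂
  PreA : V p q → V p q → Set
  PreA x y =
    x ~ y
    ⊎ (Σ (Fin p) λ i → Σ (Fin q) λ j → Inevitable i j × x ~ inj₁ i × y ~ inj₂ j)
    ⊎ (Σ (Fin p) λ i → Σ (Fin q) λ j → Forbidden i j × y ~ inj₁ i × x ~ inj₂ j)

  _≤A_ : V p q → V p q → Set
  _≤A_ = Star PreA

  IsComponentSet : (V p q → Bool) → Set
  IsComponentSet I = ∀ x y → x ~ y → I x ≡ I y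

  IsLowerIdeal : (V p q → Bool) → Set
  IsLowerIdeal I = IsComponentSet I × (∀ x y → x ≤A y → I y ≡ true → I x ≡ true)

  IsUpperIdeal : (V p q → Bool) → Set
  IsUpperIdeal I = IsComponentSet I × (∀ x y → x ≤A y → I x ≡ true → I y ≡ true)

  IsNormalizedLowerIdeal : (V p q → Bool) → Set
  IsNormalizedLowerIdeal I = IsLowerIdeal I ×
    (∀ x → Inc sideA x → I x ≡ true) × (∀ x → Inc sideB x → I x ≡ true → ⊥)

  IsNormalizedUpperIdeal : (V p q → Bool) → Set
  IsNormalizedUpperIdeal I = IsUpperIdeal I ×
    (∀ x → Inc sideA x → I x ≡ true → ⊥) × (∀ x → Inc sideB x → I x ≡ true)

  verCost : (V p q → Bool) → ℕ
  verCost Z =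
    sumFin p (λ i → if Z (inj₁ i) then 0 else b (inj₁ i))
    + sumFin q (λ j → if Z (inj₂ j) then 0 else b (inj₂ j))
    + sumFin p (λ i → sumFin q (λ j → [ E i j ∧ (Z (inj₁ i) ∧ Z (inj₂ j)) ]))

  IsBVerifying : (V p q → Bool) → Set
  IsBVerifying Z = Σ EdgeSet λ M → IsMaxBMatching M × verCost Z ≡ size M

module Submission where

-- Label every vertex by  zLabel Z :  a vertex of A gets 'true' iff it lies in Z,
-- a vertex of B gets 'true' iff it lies outside Z.  The theorem says that Z is
-- b-verifying iff this labelling is the indicator of a normalized lower ideal I_A
-- (its complement then being the normalized upper ideal I_B).
--
--  * LP duality.  For every b-matching M and every Z we have  |M| ≤ cost(Z), by
--    charging each edge of M to its endpoints outside Z (or to itself if both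
--    ends are in Z).  Equality holds iff the complementary slackness conditions
--    hold: vertices outside Z are saturated, edges of G inside Z are in M, and no
--    edge of M has both ends outside Z.
--  * Since a maximum b-matching exists (by finite search), Z is verifying iff it
--    satisfies complementary slackness with every / some maximum b-matching.
--    Complementary slackness for all maximum matchings is exactly what makes
--    zLabel Z constant on flexible components, closed downwards along
--    inevitable and forbidden edges, and compatible with the loose and inactive
--    components; conversely such a labelling forces slackness.
--  * Bookkeeping: a disjoint covering pair of normalized ideals matching Z on
--    A and B is the same thing as the labelling zLabel Z with its complement.

open import Defs
open import Data.Nat using (ℕ; zero; suc; _+_; _≤_; z≤n; s≤s; _≤?_)
open import Data.Nat.Properties
  using (≤-refl; ≤-trans; ≤-antisym; ≤-reflexive; <-irrefl; m≤n⇒m<n∨m≡n; +-mono-≤; +-cancelˡ-≡; +-cancelʳ-≡;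
         +-cancelʳ-≤; m≤m+n; m≤n+m; ≤-totalOrder; +-commutativeSemigroup)
open import Algebra.Properties.CommutativeSemigroup +-commutativeSemigroup using (interchange)
open import Data.Fin using (Fin; zero; suc)
open import Data.Fin.Properties using (all?)
open import Data.Bool using (Bool; true; false; _∧_; not; if_then_else_)
open import Data.Bool.Properties using (not-involutive) renaming (_≟_ to _≟ᵇ_)
open import Data.Sum using (_⊎_; inj₁; inj₂)
open import Data.Product using (Σ; _×_; _,_; proj₁; proj₂)
open import Data.Empty using (⊥; ⊥-elim)
open import Data.Unit using (tt)
open import Data.List using (List; []; _∷_; filter; cartesianProductWith)
open import Data.List.Relation.Unary.Any using (Any; here; there)
open import Data.List.Relation.Unary.Any.Properties using (cartesianProductWith⁺; filter⁺; lookup-result)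
open import Data.List.Relation.Unary.All using (lookupWith)
open import Data.List.Relation.Unary.All.Properties using (all-filter)
open import Data.List.Extrema ≤-totalOrder using (argmax; argmax-all; f[xs]≤f[argmax])
open import Data.Vec.Functional using () renaming (_∷_ to _◂_)
open import Function using (_∘_; id)
open import Relation.Nullary using (Dec)
open import Relation.Nullary.Decidable using (_×-dec_; _→-dec_; map′)
open import Relation.Binary.Construct.Closure.ReflexiveTransitive using (ε; _◅_; fold)
open import Relation.Binary.PropositionalEquality
  using (_≡_; refl; sym; trans; cong; cong₂; subst; _≗_; module ≡-Reasoning)

sum-cong : ∀ n {f g : Fin n → ℕ} → (∀ k → f k ≡ g k) → sumFin n f ≡ sumFin n g
sum-cong zero    f≗g = refl
sum-cong (suc n) f≗g = cong₂ _+_ (f≗g zero) (sum-cong n (f≗g ∘ suc))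

sum-zero : ∀ n → sumFin n (λ _ → 0) ≡ 0
sum-zero zero    = refl
sum-zero (suc n) = sum-zero n

sum-+ : ∀ n (f g : Fin n → ℕ) → sumFin n (λ k → f k + g k) ≡ sumFin n f + sumFin n g
sum-+ zero    f g = refl
sum-+ (suc n) f g =
  trans (cong (f zero + g zero +_) (sum-+ n (f ∘ suc) (g ∘ suc))) (interchange (f zero) (g zero) _ _)

sum-swap : ∀ m n (f : Fin m → Fin n → ℕ) →
  sumFin m (λ i → sumFin n (f i)) ≡ sumFin n (λ j → sumFin m (λ i → f i j))
sum-swap zero    n f = sym (sum-zero n)
sum-swap (suc m) n f =
  trans (cong (sumFin n (f zero) +_) (sum-swap m n (f ∘ suc)))
        (sym (sum-+ n (f zero) (λ j → sumFin m (λ i → f (suc i) j))))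

sum-mono : ∀ n {f g : Fin n → ℕ} → (∀ k → f k ≤ g k) → sumFin n f ≤ sumFin n g
sum-mono zero    f≤g = z≤n
sum-mono (suc n) f≤g = +-mono-≤ (f≤g zero) (sum-mono n (f≤g ∘ suc))

term≤sum : ∀ n (f : Fin n → ℕ) k → f k ≤ sumFin n f
term≤sum (suc n) f zero    = m≤m+n (f zero) _
term≤sum (suc n) f (suc k) = ≤-trans (term≤sum n (f ∘ suc) k) (m≤n+m _ (f zero))

+-tight : ∀ {a b c d} → a ≤ c → b ≤ d → a + b ≡ c + d → a ≡ c × b ≡ d
+-tight {a} {b} {c} {d} a≤c b≤d eq = a≡c , +-cancelˡ-≡ c b d (subst (λ x → x + b ≡ c + d) a≡c eq)
  where
    c+d≤a+d : c + d ≤ a + d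
    c+d≤a+d = subst (_≤ a + d) eq (+-mono-≤ (≤-refl {a}) b≤d)
    a≡c : a ≡ c
    a≡c = ≤-antisym a≤c (+-cancelʳ-≤ d c a c+d≤a+d)

sum-tight : ∀ n {f g : Fin n → ℕ} → (∀ k → f k ≤ g k) → sumFin n f ≡ sumFin n g → ∀ k → f k ≡ g k
sum-tight (suc n) f≤g eq zero    = proj₁ (+-tight (f≤g zero) (sum-mono n (f≤g ∘ suc)) eq)
sum-tight (suc n) f≤g eq (suc k) =
  sum-tight n (f≤g ∘ suc) (proj₂ (+-tight (f≤g zero) (sum-mono n (f≤g ∘ suc)) eq)) k

squeeze : ∀ {a b c} → a ≤ b → b ≤ c → a ≡ c → a ≡ b × b ≡ c
squeeze a≤b b≤c refl = ≤-antisym a≤b b≤c , ≤-antisym b≤c a≤b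

sum₂ : ∀ {p q} → (Fin p → Fin q → ℕ) → ℕ
sum₂ {p} {q} f = sumFin p (λ i → sumFin q (f i))

sumV : ∀ {p q} → (V p q → ℕ) → ℕ
sumV {p} {q} f = sumFin p (f ∘ inj₁) + sumFin q (f ∘ inj₂)

sum₂-cong : ∀ {p q} {f g : Fin p → Fin q → ℕ} → (∀ i j → f i j ≡ g i j) → sum₂ f ≡ sum₂ g
sum₂-cong {p} {q} f≗g = sum-cong p (λ i → sum-cong q (f≗g i))

sum₂-+ : ∀ {p q} (f g : Fin p → Fin q → ℕ) → sum₂ (λ i j → f i j + g i j) ≡ sum₂ f + sum₂ g
sum₂-+ {p} {q} f g = trans (sum-cong p (λ i → sum-+ q (f i) (g i))) (sum-+ p _ _)

sum₂-tight : ∀ {p q} {f g : Fin p → Fin q → ℕ} →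
  (∀ i j → f i j ≤ g i j) → sum₂ f ≡ sum₂ g → ∀ i j → f i j ≡ g i j
sum₂-tight {p} {q} f≤g eq i =
  sum-tight q (f≤g i) (sum-tight p (λ i → sum-mono q (f≤g i)) eq i)

sumV-cong : ∀ {p q} {f g : V p q → ℕ} → (∀ v → f v ≡ g v) → sumV f ≡ sumV g
sumV-cong {p} {q} f≗g = cong₂ _+_ (sum-cong p (f≗g ∘ inj₁)) (sum-cong q (f≗g ∘ inj₂))

sumV-mono : ∀ {p q} {f g : V p q → ℕ} → (∀ v → f v ≤ g v) → sumV f ≤ sumV g
sumV-mono {p} {q} f≤g = +-mono-≤ (sum-mono p (f≤g ∘ inj₁)) (sum-mono q (f≤g ∘ inj₂))

sumV-tight : ∀ {p q} {f g : V p q → ℕ} → (∀ v → f v ≤ g v) → sumV f ≡ sumV g → ∀ v → f v ≡ g v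
sumV-tight {p} {q} f≤g eq (inj₁ i) =
  sum-tight p (f≤g ∘ inj₁) (proj₁ (+-tight (sum-mono p (f≤g ∘ inj₁)) (sum-mono q (f≤g ∘ inj₂)) eq)) i
sumV-tight {p} {q} f≤g eq (inj₂ j) =
  sum-tight q (f≤g ∘ inj₂) (proj₂ (+-tight (sum-mono p (f≤g ∘ inj₁)) (sum-mono q (f≤g ∘ inj₂)) eq)) j

sum-guarded : ∀ n z (f : Fin n → Bool) →
  sumFin n (λ k → [ not z ∧ f k ]) ≡ (if z then 0 else sumFin n (λ k → [ f k ]))
sum-guarded n true  f = sum-zero n
sum-guarded n false f = refl

if-mono : ∀ z {x y} → x ≤ y → (if z then 0 else x) ≤ (if z then 0 else y)
if-mono true  x≤y = z≤n
if-mono false x≤y = x≤y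

if-tight : ∀ {z x y} → (if z then 0 else x) ≡ (if z then 0 else y) → z ≡ false → x ≡ y
if-tight eq refl = eq

if-cong : ∀ z {x y} → (z ≡ false → x ≡ y) → (if z then 0 else x) ≡ (if z then 0 else y)
if-cong true  h = refl
if-cong false h = h refl

-- The charge of a single edge slot ij:  m = [ij ∈ M], e = [ij ∈ E],
-- zi, zj = membership of the ends in Z.  An edge of M is charged once to each
-- end outside Z, an edge of G with both ends in Z is charged to itself.

charge : Bool → Bool → Bool → Bool → ℕ
charge m e zi zj = [ not zi ∧ m ] + [ not zj ∧ m ] + [ e ∧ (zi ∧ zj) ]

charge-pays : ∀ {m e} zi zj → (m ≡ true → e ≡ true) → [ m ] ≤ charge m e zi zj
charge-pays {false} zi    zj    m⊆e = z≤n
charge-pays {true}  false zj    m⊆e = s≤s z≤n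
charge-pays {true}  true  false m⊆e = s≤s z≤n
charge-pays {true}  true  true  m⊆e rewrite m⊆e refl = s≤s z≤n

tight⇒covers : ∀ {m e zi zj} → [ m ] ≡ charge m e zi zj →
  e ≡ true → zi ≡ true → zj ≡ true → m ≡ true
tight⇒covers {true}  eq    _    _    _    = refl
tight⇒covers {false} () refl refl refl

tight⇒separated : ∀ {m e zi zj} → [ m ] ≡ charge m e zi zj →
  m ≡ true → zi ≡ false → zj ≡ false → ⊥
tight⇒separated {e = true}  () refl refl refl
tight⇒separated {e = false} () refl refl refl

slack⇒tight : ∀ m e zi zj → (m ≡ true → e ≡ true) →
  (e ≡ true → zi ≡ true → zj ≡ true → m ≡ true) → (m ≡ true → zi ≡ false → zj ≡ false → ⊥) →
  [ m ] ≡ charge m e zi zj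
slack⇒tight true  true  true  true  m⊆e covers sep = refl
slack⇒tight true  false true  true  m⊆e covers sep with () ← m⊆e refl
slack⇒tight true  true  true  false m⊆e covers sep = refl
slack⇒tight true  false true  false m⊆e covers sep = refl
slack⇒tight true  true  false true  m⊆e covers sep = refl
slack⇒tight true  false false true  m⊆e covers sep = refl
slack⇒tight true  e     false false m⊆e covers sep = ⊥-elim (sep refl refl refl)
slack⇒tight false true  true  true  m⊆e covers sep with () ← covers refl refl refl
slack⇒tight false true  true  false m⊆e covers sep = refl
slack⇒tight false true  false true  m⊆e covers sep = refl
slack⇒tight false true  false false m⊆e covers sep = refl
slack⇒tight false false true  true  m⊆e covers sep = refl
slack⇒tight false false true  false m⊆e covers sep = refl
slack⇒tight false false false true  m⊆e covers sep = refl
slack⇒tight false false false false m⊆e covers sep = refl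

-- Functions from a finite set, enumerated up to pointwise equality; this is the
-- exhaustive search that produces a maximum b-matching.

allFunctions : ∀ {X : Set} n → List X → List (Fin n → X)
allFunctions zero    xs = (λ ()) ∷ []
allFunctions (suc n) xs = cartesianProductWith _◂_ xs (allFunctions n xs)

allFunctions-complete : ∀ {X : Set} (R : X → X → Set) {xs : List X} → (∀ x → Any (R x) xs) →
  ∀ n (f : Fin n → X) → Any (λ g → ∀ k → R (f k) (g k)) (allFunctions n xs)
allFunctions-complete R listed zero    f = here (λ ())
allFunctions-complete R listed (suc n) f =
  cartesianProductWith⁺ _◂_ extend (listed (f zero)) (allFunctions-complete R listed n (f ∘ suc))
  where
    extend : ∀ {x g} → R (f zero) x → (∀ k → R (f (suc k)) (g k)) → ∀ k → R (f k) ((x ◂ g) k)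
    extend r rs zero    = r
    extend r rs (suc k) = rs k

allV? : ∀ {p q} {P : V p q → Set} → (∀ v → Dec (P v)) → Dec (∀ v → P v)
allV? P? = map′ (λ { (onA , onB) (inj₁ i) → onA i ; (onA , onB) (inj₂ j) → onB j })
                (λ all → (all ∘ inj₁) , (all ∘ inj₂))
                (all? (P? ∘ inj₁) ×-dec all? (P? ∘ inj₂))

false≢true : false ≡ true → ⊥
false≢true ()

not-true⇒false : ∀ {c} → not c ≡ true → c ≡ false
not-true⇒false {false} refl = refl

¬true⇒not : ∀ {c} → (c ≡ true → ⊥) → not c ≡ true
¬true⇒not {true}  c≢true = ⊥-elim (c≢true refl)
¬true⇒not {false} c≢true = refl

excludedMiddle : ∀ c → c ≡ true ⊎ not c ≡ true
excludedMiddle true  = inj₁ refl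
excludedMiddle false = inj₂ refl

partition⇒not : ∀ {a c} → a ≡ true ⊎ c ≡ true → (a ≡ true → c ≡ true → ⊥) → c ≡ not a
partition⇒not {true}  {true}  _         disj = ⊥-elim (disj refl refl)
partition⇒not {true}  {false} _         disj = refl
partition⇒not {false} {true}  _         disj = refl
partition⇒not {false} {false} (inj₁ ()) disj
partition⇒not {false} {false} (inj₂ ()) disj

zLabel : ∀ {p q} → (V p q → Bool) → V p q → Bool
zLabel Z (inj₁ i) = Z (inj₁ i)
zLabel Z (inj₂ j) = not (Z (inj₂ j))

module _ {p q : ℕ} (E : Fin p → Fin q → Bool) (b : V p q → ℕ) where

  -- LP duality between b-matchings and verifying sets.  By definition
  -- verCost Z = sumV (outsideCharge Z) + insideEdges Z.

  outsideCharge : (V p q → Bool) → V p q → ℕ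
  outsideCharge Z v = if Z v then 0 else b v

  outsideDeg : (V p q → Bool) → EdgeSet E b → V p q → ℕ
  outsideDeg Z M v = if Z v then 0 else deg E b M v

  insideEdges : (V p q → Bool) → ℕ
  insideEdges Z = sum₂ (λ i j → [ E i j ∧ (Z (inj₁ i) ∧ Z (inj₂ j)) ])

  edgeCharge : (V p q → Bool) → EdgeSet E b → Fin p → Fin q → ℕ
  edgeCharge Z M i j = charge (M i j) (E i j) (Z (inj₁ i)) (Z (inj₂ j))

  edgeCharge-total : ∀ Z M → sum₂ (edgeCharge Z M) ≡ sumV (outsideDeg Z M) + insideEdges Z
  edgeCharge-total Z M = begin
    sum₂ (edgeCharge Z M)
      ≡⟨ sum₂-+ (λ i j → [ not (Z (inj₁ i)) ∧ M i j ] + [ not (Z (inj₂ j)) ∧ M i j ]) _ ⟩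
    sum₂ (λ i j → [ not (Z (inj₁ i)) ∧ M i j ] + [ not (Z (inj₂ j)) ∧ M i j ]) + insideEdges Z
      ≡⟨ cong (_+ insideEdges Z) (trans (sum₂-+ {p} {q} _ _) (cong₂ _+_ onA onB)) ⟩
    sumV (outsideDeg Z M) + insideEdges Z ∎
    where
      open ≡-Reasoning
      onA : sum₂ (λ i j → [ not (Z (inj₁ i)) ∧ M i j ]) ≡ sumFin p (outsideDeg Z M ∘ inj₁)
      onA = sum-cong p (λ i → sum-guarded q (Z (inj₁ i)) (M i))
      onB : sum₂ (λ i j → [ not (Z (inj₂ j)) ∧ M i j ]) ≡ sumFin q (outsideDeg Z M ∘ inj₂)
      onB = trans (sum-swap p q _) (sum-cong q (λ j → sum-guarded p (Z (inj₂ j)) (λ i → M i j)))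

  size≤charges : ∀ Z M → IsBMatching E b M → size E b M ≤ sum₂ (edgeCharge Z M)
  size≤charges Z M (M⊆E , _) =
    sum-mono p (λ i → sum-mono q (λ j → charge-pays (Z (inj₁ i)) (Z (inj₂ j)) (M⊆E i j)))

  charges≤cost : ∀ Z M → IsBMatching E b M → sumV (outsideDeg Z M) + insideEdges Z ≤ verCost E b Z
  charges≤cost Z M (_ , degM≤b) = +-mono-≤ (sumV-mono (λ v → if-mono (Z v) (degM≤b v))) ≤-refl

  record Slackness (Z : V p q → Bool) (M : EdgeSet E b) : Set where
    field
      saturated : ∀ v → Z v ≡ false → deg E b M v ≡ b v
      covers    : ∀ i j → E i j ≡ true → Z (inj₁ i) ≡ true → Z (inj₂ j) ≡ true → M i j ≡ true
      separated : ∀ i j → M i j ≡ true → Z (inj₁ i) ≡ false → Z (inj₂ j) ≡ false → ⊥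

  tight⇒slackness : ∀ Z M → IsBMatching E b M → verCost E b Z ≡ size E b M → Slackness Z M
  tight⇒slackness Z M isBM cost≡size = record
    { saturated = λ v → if-tight (vertexTight v)
    ; covers    = λ i j → tight⇒covers (edgeTight i j)
    ; separated = λ i j → tight⇒separated {e = E i j} (edgeTight i j)
    }
    where
      squeezed : size E b M ≡ sum₂ (edgeCharge Z M) × sum₂ (edgeCharge Z M) ≡ verCost E b Z
      squeezed = squeeze (size≤charges Z M isBM)
                   (≤-trans (≤-reflexive (edgeCharge-total Z M)) (charges≤cost Z M isBM))
                   (sym cost≡size)
      edgeTight : ∀ i j → [ M i j ] ≡ edgeCharge Z M i j
      edgeTight = sum₂-tight (λ i j → charge-pays (Z (inj₁ i)) (Z (inj₂ j)) (proj₁ isBM i j))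
                    (proj₁ squeezed)
      vertexTight : ∀ v → outsideDeg Z M v ≡ outsideCharge Z v
      vertexTight = sumV-tight (λ v → if-mono (Z v) (proj₂ isBM v))
        (+-cancelʳ-≡ (insideEdges Z) _ _ (trans (sym (edgeCharge-total Z M)) (proj₂ squeezed)))

  slackness⇒tight : ∀ Z M → IsBMatching E b M → Slackness Z M → verCost E b Z ≡ size E b M
  slackness⇒tight Z M (M⊆E , _) slack = begin
    verCost E b Z
      ≡⟨⟩
    sumV (outsideCharge Z) + insideEdges Z
      ≡⟨ cong (_+ insideEdges Z) (sumV-cong (λ v → sym (if-cong (Z v) (saturated v)))) ⟩
    sumV (outsideDeg Z M) + insideEdges Z
      ≡⟨ sym (edgeCharge-total Z M) ⟩
    sum₂ (edgeCharge Z M)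
      ≡⟨ sym (sum₂-cong λ i j → slack⇒tight (M i j) (E i j) (Z (inj₁ i)) (Z (inj₂ j))
                                   (M⊆E i j) (covers i j) (separated i j)) ⟩
    size E b M ∎
    where
      open ≡-Reasoning
      open Slackness slack

  noEdges : EdgeSet E b
  noEdges _ _ = false

  noEdges-isBMatching : IsBMatching E b noEdges
  noEdges-isBMatching = (λ i j ()) , λ where
    (inj₁ i) → ≤-trans (≤-reflexive (sum-zero q)) z≤n
    (inj₂ j) → ≤-trans (≤-reflexive (sum-zero p)) z≤n

  isBMatching? : ∀ M → Dec (IsBMatching E b M)
  isBMatching? M = all? (λ i → all? (λ j → (M i j ≟ᵇ true) →-dec (E i j ≟ᵇ true)))
                   ×-dec allV? (λ v → deg E b M v ≤? b v)

  size-resp : ∀ {M M'} → (∀ i j → M i j ≡ M' i j) → size E b M ≡ size E b M'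
  size-resp M≐M' = sum₂-cong (λ i j → cong [_] (M≐M' i j))

  isBMatching-resp : ∀ {M M'} → (∀ i j → M i j ≡ M' i j) → IsBMatching E b M → IsBMatching E b M'
  isBMatching-resp {M} {M'} M≐M' (M⊆E , degM≤b) = (λ i j → M⊆E i j ∘ trans (M≐M' i j)) , λ where
    (inj₁ i) → subst (_≤ b (inj₁ i)) (sum-cong q (λ j → cong [_] (M≐M' i j))) (degM≤b (inj₁ i))
    (inj₂ j) → subst (_≤ b (inj₂ j)) (sum-cong p (λ i → cong [_] (M≐M' i j))) (degM≤b (inj₂ j))

  allEdgeSets : List (EdgeSet E b)
  allEdgeSets = allFunctions p (allFunctions q (true ∷ false ∷ []))

  allEdgeSets-complete : ∀ M → Any (λ M' → ∀ i j → M i j ≡ M' i j) allEdgeSets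
  allEdgeSets-complete = allFunctions-complete _≗_ (allFunctions-complete _≡_ listed q) p
    where
      listed : ∀ x → Any (x ≡_) (true ∷ false ∷ [])
      listed true  = here refl
      listed false = there (here refl)

  maximumExists : Σ (EdgeSet E b) (IsMaxBMatching E b)
  maximumExists = best , bestIsBM , bestIsMax
    where
      candidates : List (EdgeSet E b)
      candidates = filter isBMatching? allEdgeSets
      best : EdgeSet E b
      best = argmax (size E b) noEdges candidates
      bestIsBM : IsBMatching E b best
      bestIsBM = argmax-all (size E b) noEdges-isBMatching (all-filter isBMatching? allEdgeSets)
      bestIsMax : ∀ M → IsBMatching E b M → size E b M ≤ size E b best
      bestIsMax M isBM with filter⁺ isBMatching? (allEdgeSets-complete M)
      ... | inj₁ listedM = lookupWith
              (λ M'≤best M≐M' → subst (_≤ size E b best) (sym (size-resp M≐M')) M'≤best)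
              (f[xs]≤f[argmax] {f = size E b} noEdges candidates) listedM
      ... | inj₂ notBM = ⊥-elim (notBM (isBMatching-resp (lookup-result (allEdgeSets-complete M)) isBM))

  -- A verifying set labels the flexible components as a normalized lower ideal

  -- Every maximum b-matching attains the cost of a verifying set.
  verifying⇒slackness : ∀ Z → IsBVerifying E b Z → ∀ M → IsMaxBMatching E b M → Slackness Z M
  verifying⇒slackness Z (M₀ , max₀ , cost≡) M max = tight⇒slackness Z M (proj₁ max)
    (trans cost≡ (≤-antisym (proj₂ max M₀ (proj₁ max₀)) (proj₂ max₀ M (proj₁ max))))

  noCapacity : ∀ {n} → n ≡ 0 → 1 ≤ n → ⊥
  noCapacity refl ()

  matched⇒capacityA : ∀ {M} → IsBMatching E b M → ∀ {i j} → M i j ≡ true → 1 ≤ b (inj₁ i)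
  matched⇒capacityA {M} (_ , degM≤b) {i} {j} mij =
    ≤-trans (subst (λ m → [ m ] ≤ deg E b M (inj₁ i)) mij (term≤sum q (λ j → [ M i j ]) j)) (degM≤b (inj₁ i))

  matched⇒capacityB : ∀ {M} → IsBMatching E b M → ∀ {i j} → M i j ≡ true → 1 ≤ b (inj₂ j)
  matched⇒capacityB {M} (_ , degM≤b) {i} {j} mij =
    ≤-trans (subst (λ m → [ m ] ≤ deg E b M (inj₂ j)) mij (term≤sum p (λ i → [ M i j ]) i)) (degM≤b (inj₂ j))

  module FromVerifying (Z : V p q → Bool) (verifying : IsBVerifying E b Z) where

    M₀ : EdgeSet E b
    M₀ = proj₁ verifying

    max₀ : IsMaxBMatching E b M₀
    max₀ = proj₁ (proj₂ verifying)

    slack : ∀ M → IsMaxBMatching E b M → Slackness Z M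
    slack = verifying⇒slackness Z verifying

    open Slackness (slack M₀ max₀) using (covers; separated)

    loose⇒inZ : ∀ v → InD E b v → Z v ≡ true
    loose⇒inZ v (M , max , loose) with Z v in zv
    ... | true  = refl
    ... | false = ⊥-elim (<-irrefl (Slackness.saturated (slack M max) v zv) loose)

    -- An inactive vertex with a neighbour in Z lies outside Z, since otherwise
    -- the edge between them would have to be matched.
    inactive⇒outside : ∀ v w → b v ≡ 0 → Adj E b v w → Z w ≡ true → Z v ≡ false
    inactive⇒outside v w b0 adj zw with Z v in zv
    ... | false = refl
    inactive⇒outside (inj₁ i) (inj₂ j) b0 adj zw | true =
      ⊥-elim (noCapacity b0 (matched⇒capacityA (proj₁ max₀) (covers i j adj zv zw)))
    inactive⇒outside (inj₂ j) (inj₁ i) b0 adj zw | true =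
      ⊥-elim (noCapacity b0 (matched⇒capacityB (proj₁ max₀) (covers i j adj zw zv)))

    -- Exactly one end of a flexible edge lies in Z.
    label-flexible : ∀ i j → Flexible E b i j → zLabel Z (inj₁ i) ≡ zLabel Z (inj₂ j)
    label-flexible i j (allowed@(e , M , max , mij) , notInevitable)
      with Z (inj₁ i) in zi | Z (inj₂ j) in zj
    ... | true  | true  = ⊥-elim (notInevitable (allowed , λ M' max' →
                            Slackness.covers (slack M' max') i j e zi zj))
    ... | true  | false = refl
    ... | false | true  = refl
    ... | false | false = ⊥-elim (Slackness.separated (slack M max) i j mij zi zj)

    label-component : ∀ {x y} → _~_ E b x y → zLabel Z x ≡ zLabel Z y
    label-component = fold (λ x y → zLabel Z x ≡ zLabel Z y) (λ adj eq → trans (step adj) eq) refl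
      where
        step : ∀ {x y} → FlexAdj E b x y → zLabel Z x ≡ zLabel Z y
        step (i , j , flex , inj₁ (refl , refl)) = label-flexible i j flex
        step (i , j , flex , inj₂ (refl , refl)) = sym (label-flexible i j flex)

    label-step : ∀ {x y} → PreA E b x y → zLabel Z y ≡ true → zLabel Z x ≡ true
    label-step (inj₁ x~y) ly = trans (label-component x~y) ly
    label-step (inj₂ (inj₁ (i , j , (_ , always) , x~i , y~j))) ly with Z (inj₁ i) in zi
    ... | true  = trans (label-component x~i) zi
    ... | false = ⊥-elim (separated i j (always M₀ max₀) zi
                           (not-true⇒false (trans (sym (label-component y~j)) ly)))
    label-step (inj₂ (inj₂ (i , j , (e , notAllowed) , y~i , x~j))) ly with Z (inj₂ j) in zj
    ... | false = trans (label-component x~j) (cong not zj)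
    ... | true  = ⊥-elim (notAllowed (e , M₀ , max₀ ,
                           covers i j e (trans (sym (label-component y~i)) ly) zj))

    label-lower : ∀ x y → _≤A_ E b x y → zLabel Z y ≡ true → zLabel Z x ≡ true
    label-lower x y = fold (λ x y → zLabel Z y ≡ true → zLabel Z x ≡ true)
                           (λ pre below ly → label-step pre (below ly)) id

    label-incA : ∀ x → Inc E b sideA x → zLabel Z x ≡ true
    label-incA x (inj₁ (inj₁ i , x~v , _ , loose)) = trans (label-component x~v) (loose⇒inZ _ loose)
    label-incA x (inj₂ (inj₂ j , x~v , b0 , _ , inj₁ i , adj , _ , loose)) =
      trans (label-component x~v) (cong not (inactive⇒outside _ _ b0 adj (loose⇒inZ _ loose)))
    label-incA x (inj₂ (inj₁ _ , _ , _ , _ , inj₁ _ , () , _))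
    label-incA x (inj₂ (inj₂ _ , _ , _ , _ , inj₂ _ , () , _))

    label-incB : ∀ x → Inc E b sideB x → zLabel Z x ≡ true → ⊥
    label-incB x (inj₁ (inj₂ j , x~v , _ , loose)) lx =
      false≢true (trans (sym (cong not (loose⇒inZ _ loose))) (trans (sym (label-component x~v)) lx))
    label-incB x (inj₂ (inj₁ i , x~v , b0 , _ , inj₂ j , adj , _ , loose)) lx =
      false≢true (trans (sym (inactive⇒outside _ _ b0 adj (loose⇒inZ _ loose)))
                        (trans (sym (label-component x~v)) lx))
    label-incB x (inj₂ (inj₁ _ , _ , _ , _ , inj₁ _ , () , _))
    label-incB x (inj₂ (inj₂ _ , _ , _ , _ , inj₂ _ , () , _))

    label-normalized : IsNormalizedLowerIdeal E b (zLabel Z)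
    label-normalized = ((λ x y → label-component) , label-lower) , label-incA , label-incB

  -- A normalized lower ideal labelling forces complementary slackness

  module FromLabelling (Z : V p q → Bool) (normalized : IsNormalizedLowerIdeal E b (zLabel Z))
                       (M : EdgeSet E b) (max : IsMaxBMatching E b M) where

    componentSet : IsComponentSet E b (zLabel Z)
    componentSet = proj₁ (proj₁ normalized)

    lower : ∀ x y → _≤A_ E b x y → zLabel Z y ≡ true → zLabel Z x ≡ true
    lower = proj₂ (proj₁ normalized)

    incA : ∀ x → Inc E b sideA x → zLabel Z x ≡ true
    incA = proj₁ (proj₂ normalized)

    incB : ∀ x → Inc E b sideB x → zLabel Z x ≡ true → ⊥
    incB = proj₂ (proj₂ normalized)

    flexible-edge : ∀ {i j} → Allowed E b i j → (Inevitable E b i j → ⊥) → _~_ E b (inj₁ i) (inj₂ j)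
    flexible-edge {i} {j} allowed notInevitable = (i , j , (allowed , notInevitable) , inj₁ (refl , refl)) ◅ ε

    -- A loose vertex outside Z would lie in a component inconsistently hooked up
    -- by its own side, which normalization puts on the wrong side of the labelling.
    saturated : ∀ v → Z v ≡ false → deg E b M v ≡ b v
    saturated v zv with m≤n⇒m<n∨m≡n (proj₂ (proj₁ max) v)
    ... | inj₂ full = full
    saturated (inj₁ i) zv | inj₁ loose =
      ⊥-elim (false≢true (trans (sym zv) (incA (inj₁ i) (inj₁ (inj₁ i , ε , tt , M , max , loose)))))
    saturated (inj₂ j) zv | inj₁ loose =
      ⊥-elim (incB (inj₂ j) (inj₁ (inj₂ j , ε , tt , M , max , loose)) (cong not zv))

    -- An unmatched edge inside Z is forbidden (else it is flexible and joins
    -- differently labelled vertices), and then the labels violate lower closure.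
    covers : ∀ i j → E i j ≡ true → Z (inj₁ i) ≡ true → Z (inj₂ j) ≡ true → M i j ≡ true
    covers i j e zi zj with M i j in mij
    ... | true  = refl
    ... | false = ⊥-elim (labelJ≢true
                    (lower (inj₂ j) (inj₁ i) (inj₂ (inj₂ (i , j , (e , notAllowed) , ε , ε)) ◅ ε) zi))
      where
        labelJ≢true : zLabel Z (inj₂ j) ≡ true → ⊥
        labelJ≢true lj = false≢true (trans (sym (cong not zj)) lj)
        notAllowed : Allowed E b i j → ⊥
        notAllowed allowed = labelJ≢true (trans (sym (componentSet _ _
          (flexible-edge allowed (λ inev → false≢true (trans (sym mij) (proj₂ inev M max)))))) zi)

    -- A matched edge with both ends outside Z is inevitable (else flexible), and
    -- then lower closure would put its A-end into the ideal.
    separated : ∀ i j → M i j ≡ true → Z (inj₁ i) ≡ false → Z (inj₂ j) ≡ false → ⊥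
    separated i j mij zi zj = labelI≢true (trans (componentSet _ _ (flexible-edge allowed notInevitable)) labelJ)
      where
        labelJ : zLabel Z (inj₂ j) ≡ true
        labelJ = cong not zj
        labelI≢true : zLabel Z (inj₁ i) ≡ true → ⊥
        labelI≢true li = false≢true (trans (sym zi) li)
        allowed : Allowed E b i j
        allowed = proj₁ (proj₁ max) i j mij , M , max , mij
        notInevitable : Inevitable E b i j → ⊥
        notInevitable inev = labelI≢true
          (lower (inj₁ i) (inj₂ j) (inj₂ (inj₁ (i , j , inev , ε , ε)) ◅ ε) labelJ)

    slackness : Slackness Z M
    slackness = record { saturated = saturated ; covers = covers ; separated = separated }

  verifying⇒labelling : ∀ Z → IsBVerifying E b Z → IsNormalizedLowerIdeal E b (zLabel Z)
  verifying⇒labelling = FromVerifying.label-normalized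

  labelling⇒verifying : ∀ Z → IsNormalizedLowerIdeal E b (zLabel Z) → IsBVerifying E b Z
  labelling⇒verifying Z normalized = M , max ,
    slackness⇒tight Z M (proj₁ max) (FromLabelling.slackness Z normalized M max)
    where
      M : EdgeSet E b
      M = proj₁ maximumExists
      max : IsMaxBMatching E b M
      max = proj₂ maximumExists

  IdealPartition : (V p q → Bool) → Set
  IdealPartition Z = Σ (V p q → Bool) λ IA → Σ (V p q → Bool) λ IB →
    IsNormalizedLowerIdeal E b IA × IsNormalizedUpperIdeal E b IB ×
    (∀ x → IA x ≡ true ⊎ IB x ≡ true) × (∀ x → IA x ≡ true → IB x ≡ true → ⊥) ×
    (∀ i → Z (inj₁ i) ≡ IA (inj₁ i)) × (∀ j → Z (inj₂ j) ≡ IB (inj₂ j))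

  normalizedLower-resp : ∀ {I J} → (∀ x → I x ≡ J x) →
    IsNormalizedLowerIdeal E b I → IsNormalizedLowerIdeal E b J
  normalizedLower-resp I≗J ((componentSet , lower) , incA , incB) =
    ( (λ x y x~y → trans (sym (I≗J x)) (trans (componentSet x y x~y) (I≗J y)))
    , (λ x y x≤y Jy → trans (sym (I≗J x)) (lower x y x≤y (trans (I≗J y) Jy))) )
    , (λ x inc → trans (sym (I≗J x)) (incA x inc))
    , (λ x inc Jx → incB x inc (trans (I≗J x) Jx))

  complement-upper : ∀ I → IsNormalizedLowerIdeal E b I → IsNormalizedUpperIdeal E b (not ∘ I)
  complement-upper I ((componentSet , lower) , incA , incB) =
    ( (λ x y x~y → cong not (componentSet x y x~y))
    , (λ x y x≤y notIx → ¬true⇒not (λ Iy → outside x notIx (lower x y x≤y Iy))) )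
    , (λ x inc notIx → outside x notIx (incA x inc))
    , (λ x inc → ¬true⇒not (incB x inc))
    where
      outside : ∀ x → not (I x) ≡ true → I x ≡ true → ⊥
      outside x notIx Ix = false≢true (trans (sym (not-true⇒false notIx)) Ix)

  labelling⇒partition : ∀ Z → IsNormalizedLowerIdeal E b (zLabel Z) → IdealPartition Z
  labelling⇒partition Z normalized =
    zLabel Z , not ∘ zLabel Z , normalized , complement-upper (zLabel Z) normalized ,
    (λ x → excludedMiddle (zLabel Z x)) ,
    (λ x lx notLx → false≢true (trans (sym (not-true⇒false notLx)) lx)) ,
    (λ i → refl) , (λ j → sym (not-involutive (Z (inj₂ j))))

  partition⇒labelling : ∀ Z → IdealPartition Z → IsNormalizedLowerIdeal E b (zLabel Z)
  partition⇒labelling Z (IA , IB , lowerA , _ , cover , disjoint , zA , zB) =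
    normalizedLower-resp (λ x → sym (label≗IA x)) lowerA
    where
      label≗IA : ∀ x → zLabel Z x ≡ IA x
      label≗IA (inj₁ i) = zA i
      label≗IA (inj₂ j) = trans (cong not (trans (zB j) (partition⇒not (cover (inj₂ j)) (disjoint (inj₂ j)))))
                                (not-involutive (IA (inj₂ j)))

mainTheorem2 : {p q : ℕ} (E : Fin p → Fin q → Bool) (b : V p q → ℕ) (Z : V p q → Bool) →
    (IsBVerifying E b Z →
      Σ (V p q → Bool) λ IA → Σ (V p q → Bool) λ IB →
        IsNormalizedLowerIdeal E b IA × IsNormalizedUpperIdeal E b IB ×
        (∀ x → IA x ≡ true ⊎ IB x ≡ true) × (∀ x → IA x ≡ true → IB x ≡ true → ⊥) ×
        (∀ i → Z (inj₁ i) ≡ IA (inj₁ i)) × (∀ j → Z (inj₂ j) ≡ IB (inj₂ j)))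
    × ((Σ (V p q → Bool) λ IA → Σ (V p q → Bool) λ IB →
        IsNormalizedLowerIdeal E b IA × IsNormalizedUpperIdeal E b IB ×
        (∀ x → IA x ≡ true ⊎ IB x ≡ true) × (∀ x → IA x ≡ true → IB x ≡ true → ⊥) ×
        (∀ i → Z (inj₁ i) ≡ IA (inj₁ i)) × (∀ j → Z (inj₂ j) ≡ IB (inj₂ j)))
      → IsBVerifying E b Z)
mainTheorem2 E b Z =
  (λ verifying → labelling⇒partition E b Z (verifying⇒labelling E b Z verifying)) ,
  (λ partition → labelling⇒verifying E b Z (partition⇒labelling E b Z partition))
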